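{- Let $N\ge2$ and let $(x_n)_{n\ge1}$ be the sequence in $\mathbb{Q}(a_1,\dots,a_N)$ given by $x_i=a_i$ ($1\le i\le N$) and $x_nx_{n+N}=x_{n+1}x_{n+N-1}+1$ for $n\ge1$. For $l\ge1$ put $c_l=\frac{x_l+x_{l+2}}{x_{l+1}}$, and let $$S_{N,1}=\begin{cases}(-1)^{r-1}\sum_{k=0}^{r-1}(-1)^k\,t_{2k+1,\mathrm{alt}}^{(2r-1)} & \text{if }N=2r,\\ (-1)^{r-1}\sum_{k=0}^{r-1}(-1)^k\,t_{2k,\mathrm{alt}}^{(2r-2)} & \text{if }N=2r-1.\end{cases}$$ Then for all $n\ge1$, $x_n+x_{n+2(N-1)}=S_{N,1}\,x_{n+N-1}$.
   Context: For $n\ge1$ and $0\le k\le n$, $t_{k,\mathrm{alt}}^{n}=\sum c_{i_1}c_{i_2}\cdots c_{i_k}$, the sum over all $1\le i_1<\cdots<i_k\le n$ such that $i_1,\dots,i_k$ alternate in parity, when $k>0$; and $t_{0,\mathrm{alt}}^{n}=2$. -}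

module Defs where

open import Algebra.Bundles using (CommutativeRing)
open import Data.Nat using (ℕ; zero; suc; _∸_; ⌊_/2⌋; _≡ᵇ_) renaming (_+_ to _+ℕ_; _*_ to _*ℕ_)
open import Data.List using (List; []; _∷_; map; _++_; foldr; filterᵇ; length; upTo)
open import Data.Bool using (Bool; true; false; not; _∧_; if_then_else_)

evenᵇ : ℕ → Bool
evenᵇ zero = true
evenᵇ (suc n) = not (evenᵇ n)

-- All sublists (order preserved) of a list; for [1..n] these are exactly
-- the increasing sequences i₁ < ⋯ < iₖ in {1,…,n}.
sublists : List ℕ → List (List ℕ)
sublists [] = [] ∷ []
sublists (x ∷ xs) = map (x ∷_) (sublists xs) ++ sublists xs

alternating : List ℕ → Bool
alternating (x ∷ y ∷ zs) = not (evenᵇ x ≡ᵇᵇ evenᵇ y) ∧ alternating (y ∷ zs)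
  where
  _≡ᵇᵇ_ : Bool → Bool → Bool
  true ≡ᵇᵇ b = b
  false ≡ᵇᵇ b = not b
alternating _ = true

range1 : ℕ → List ℕ
range1 n = map suc (upTo n)

module _ {c ℓ} (R : CommutativeRing c ℓ) where
  open CommutativeRing R

  pow : Carrier → ℕ → Carrier
  pow x zero = 1#
  pow x (suc m) = x * pow x m

  sumTo : ℕ → (ℕ → Carrier) → Carrier
  sumTo zero f = 0#
  sumTo (suc m) f = sumTo m f + f m

  tAlt : (ℕ → Carrier) → ℕ → ℕ → Carrier
  tAlt c n zero = 1# + 1#
  tAlt c n (suc k) =
    foldr _+_ 0# (map (λ is → foldr _*_ 1# (map c is))
      (filterᵇ (λ is → (length is ≡ᵇ suc k) ∧ alternating is) (sublists (range1 n))))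

  -- S_{N,1}: for N = 2r (r = ⌊N/2⌋) and N = 2r-1 (r = ⌊N/2⌋ + 1)
  S₁ : (ℕ → Carrier) → ℕ → Carrier
  S₁ c N = if evenᵇ N then Seven ⌊ N /2⌋ else Sodd (suc ⌊ N /2⌋)
    where
    Seven : ℕ → Carrier
    Seven r = pow (- 1#) (r ∸ 1) *
      sumTo r (λ k → pow (- 1#) k * tAlt c ((2 *ℕ r) ∸ 1) (suc (2 *ℕ k)))
    Sodd : ℕ → Carrier
    Sodd r = pow (- 1#) (r ∸ 1) *
      sumTo r (λ k → pow (- 1#) k * tAlt c ((2 *ℕ r) ∸ 2) (2 *ℕ k))

  -- c_l = (x_l + x_{l+2}) / x_{l+1}, with inv l the inverse of x l
  cSeq : (x inv : ℕ → Carrier) → ℕ → Carrier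
  cSeq x inv l = (x l + x (2 +ℕ l)) * inv (suc l)

module Submission where

-- The sequence linearises: x_{l+2} = c_l x_{l+1} - x_l, and the relation
-- x_l x_{l+N} - x_{l+1} x_{l+N-1} = 1 = x_{l+1} x_{l+N+1} - x_{l+2} x_{l+N} makes c periodic
-- with period m = N - 1. Hence both (x_{m+2}, x_{m+1}) and (x_{2m+2}, x_{2m+1}) arise from the
-- preceding pair by the same transfer matrix P = ∏ [[c_l, -1], [1, 0]], which has determinant 1,
-- and Cayley–Hamilton gives x_1 + x_{1+2m} = tr P · x_{1+m}. The same unimodular relation shows
-- that (x_n + x_{n+2m}) / x_{n+m} does not depend on n. Finally, writing [[c, -1], [1, 0]] as
-- c E₁₁ + J with J² = -1 and expanding the product, the nonzero terms of tr P are indexed by the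
-- index sets of alternating parity, weighted by powers of -1; regrouping them by cardinality
-- gives S_{N,1}.

open import Defs
open import Algebra.Bundles using (CommutativeRing)
open import Algebra.Solver.Ring.AlmostCommutativeRing
  using (fromCommutativeRing; _-Raw-AlmostCommutative⟶_)
open import Data.Bool using (Bool; true; false; not; _∧_; _xor_; if_then_else_)
import Data.Bool.Properties as Boolₚ
open import Data.Integer as ℤ using (ℤ; +_; -[1+_])
import Data.Integer.Properties as ℤₚ
open import Data.List using (List; []; _∷_; map; _++_; foldr; filterᵇ; length; upTo; applyUpTo)
import Data.List.Properties as Listₚ
open import Data.Maybe using (Maybe; just; nothing)
open import Data.Nat as ℕ using (ℕ; zero; suc; _≤_; _<_; z≤n; s≤s; _≡ᵇ_; _∸_; ⌊_/2⌋)
import Data.Nat.Properties as ℕₚ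
open import Data.Nat.Tactic.RingSolver using (solve-∀)
open import Data.Product using (_×_; _,_; ∃-syntax)
open import Data.Sum using (_⊎_; inj₁; inj₂)
open import Function using (id)
open import Relation.Binary.PropositionalEquality as ≡ using (_≡_)
open import Relation.Nullary using (yes; no)

-- The standard library's ring solver needs coefficients mapping into the ring; for an
-- arbitrary commutative ring these are the integers, via the initial map ℤ → R.
module IntegerCoefficients {c ℓ} (R : CommutativeRing c ℓ) where
  open CommutativeRing R
  open import Algebra.Properties.Ring ring using (-‿distribˡ-*; -‿distribʳ-*)
  open import Algebra.Properties.AbelianGroup +-abelianGroup
    using (ε⁻¹≈ε; ⁻¹-involutive; ⁻¹-∙-comm; xyx⁻¹≈y)
  open import Algebra.Properties.Semiring.Mult.TCOptimised semiring
    using (×-homo-+; ×1-homo-*; 1+×) renaming (_×_ to _×ᴿ_)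
  open import Relation.Binary.Reasoning.Setoid setoid

  ⟦_⟧ : ℤ → Carrier
  ⟦ + n ⟧ = n ×ᴿ 1#
  ⟦ -[1+ n ] ⟧ = - (suc n ×ᴿ 1#)

  ⟦-⟧-homo : ∀ i → ⟦ ℤ.- i ⟧ ≈ - ⟦ i ⟧
  ⟦-⟧-homo -[1+ n ] = sym (⁻¹-involutive _)
  ⟦-⟧-homo (+ zero) = sym ε⁻¹≈ε
  ⟦-⟧-homo (+ suc n) = refl

  ⟦⊖⟧-homo : ∀ m n → ⟦ m ℤ.⊖ n ⟧ ≈ m ×ᴿ 1# - n ×ᴿ 1#
  ⟦⊖⟧-homo m zero = begin
    ⟦ m ℤ.⊖ 0 ⟧         ≡⟨ ≡.cong ⟦_⟧ (ℤₚ.⊖-≥ {m} {0} z≤n) ⟩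
    m ×ᴿ 1#             ≈⟨ +-identityʳ _ ⟨
    m ×ᴿ 1# + 0#        ≈⟨ +-congˡ ε⁻¹≈ε ⟨
    m ×ᴿ 1# - 0 ×ᴿ 1#   ∎
  ⟦⊖⟧-homo zero (suc n) = begin
    ⟦ 0 ℤ.⊖ suc n ⟧     ≡⟨ ≡.cong ⟦_⟧ (ℤₚ.⊖-≤ {0} {suc n} z≤n) ⟩
    - (suc n ×ᴿ 1#)     ≈⟨ +-identityˡ _ ⟨
    0# - suc n ×ᴿ 1#    ∎
  ⟦⊖⟧-homo (suc m) (suc n) = begin
    ⟦ suc m ℤ.⊖ suc n ⟧                ≡⟨ ≡.cong ⟦_⟧ (ℤₚ.[1+m]⊖[1+n]≡m⊖n m n) ⟩
    ⟦ m ℤ.⊖ n ⟧                        ≈⟨ ⟦⊖⟧-homo m n ⟩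
    m ×ᴿ 1# - n ×ᴿ 1#                  ≈⟨ +-congʳ (xyx⁻¹≈y 1# (m ×ᴿ 1#)) ⟨
    1# + m ×ᴿ 1# - 1# - n ×ᴿ 1#        ≈⟨ +-assoc _ _ _ ⟩
    1# + m ×ᴿ 1# + (- 1# - n ×ᴿ 1#)    ≈⟨ +-congˡ (⁻¹-∙-comm 1# (n ×ᴿ 1#)) ⟩
    1# + m ×ᴿ 1# - (1# + n ×ᴿ 1#)      ≈⟨ +-cong (1+× m 1#) (-‿cong (1+× n 1#)) ⟨
    suc m ×ᴿ 1# - suc n ×ᴿ 1#          ∎

  ⟦+⟧-homo : ∀ i j → ⟦ i ℤ.+ j ⟧ ≈ ⟦ i ⟧ + ⟦ j ⟧
  ⟦+⟧-homo (+ m) (+ n) = ×-homo-+ 1# m n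
  ⟦+⟧-homo (+ m) -[1+ n ] = ⟦⊖⟧-homo m (suc n)
  ⟦+⟧-homo -[1+ m ] (+ n) = trans (⟦⊖⟧-homo n (suc m)) (+-comm _ _)
  ⟦+⟧-homo -[1+ m ] -[1+ n ] = begin
    - (suc (suc (m ℕ.+ n)) ×ᴿ 1#)   ≡⟨ ≡.cong (λ k → - (suc k ×ᴿ 1#)) (ℕₚ.+-suc m n) ⟨
    - ((suc m ℕ.+ suc n) ×ᴿ 1#)     ≈⟨ -‿cong (×-homo-+ 1# (suc m) (suc n)) ⟩
    - (suc m ×ᴿ 1# + suc n ×ᴿ 1#)   ≈⟨ ⁻¹-∙-comm _ _ ⟨
    - (suc m ×ᴿ 1#) - suc n ×ᴿ 1#   ∎

  ⟦*⟧-homo-+ : ∀ i n → ⟦ i ℤ.* + n ⟧ ≈ ⟦ i ⟧ * ⟦ + n ⟧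
  ⟦*⟧-homo-+ (+ m) n = begin
    ⟦ + m ℤ.* + n ⟧     ≡⟨ ≡.cong ⟦_⟧ (ℤₚ.pos-* m n) ⟨
    (m ℕ.* n) ×ᴿ 1#     ≈⟨ ×1-homo-* m n ⟩
    m ×ᴿ 1# * n ×ᴿ 1#   ∎
  ⟦*⟧-homo-+ -[1+ m ] n = begin
    ⟦ ℤ.- + suc m ℤ.* + n ⟧     ≡⟨ ≡.cong ⟦_⟧ (ℤₚ.neg-distribˡ-* (+ suc m) (+ n)) ⟨
    ⟦ ℤ.- (+ suc m ℤ.* + n) ⟧   ≈⟨ ⟦-⟧-homo (+ suc m ℤ.* + n) ⟩
    - ⟦ + suc m ℤ.* + n ⟧       ≈⟨ -‿cong (⟦*⟧-homo-+ (+ suc m) n) ⟩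
    - (⟦ + suc m ⟧ * ⟦ + n ⟧)   ≈⟨ -‿distribˡ-* _ _ ⟩
    - ⟦ + suc m ⟧ * ⟦ + n ⟧     ∎

  ⟦*⟧-homo : ∀ i j → ⟦ i ℤ.* j ⟧ ≈ ⟦ i ⟧ * ⟦ j ⟧
  ⟦*⟧-homo i (+ n) = ⟦*⟧-homo-+ i n
  ⟦*⟧-homo i -[1+ n ] = begin
    ⟦ i ℤ.* ℤ.- + suc n ⟧     ≡⟨ ≡.cong ⟦_⟧ (ℤₚ.neg-distribʳ-* i (+ suc n)) ⟨
    ⟦ ℤ.- (i ℤ.* + suc n) ⟧   ≈⟨ ⟦-⟧-homo (i ℤ.* + suc n) ⟩
    - ⟦ i ℤ.* + suc n ⟧       ≈⟨ -‿cong (⟦*⟧-homo-+ i (suc n)) ⟩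
    - (⟦ i ⟧ * ⟦ + suc n ⟧)   ≈⟨ -‿distribʳ-* _ _ ⟩
    ⟦ i ⟧ * - ⟦ + suc n ⟧     ∎

  homomorphism : ℤ.+-*-rawRing -Raw-AlmostCommutative⟶ fromCommutativeRing R
  homomorphism = record
    { ⟦_⟧ = ⟦_⟧ ; +-homo = ⟦+⟧-homo ; *-homo = ⟦*⟧-homo ; -‿homo = ⟦-⟧-homo
    ; 0-homo = refl ; 1-homo = refl }

  ≟-coefficients : ∀ i j → Maybe (⟦ i ⟧ ≈ ⟦ j ⟧)
  ≟-coefficients i j with i ℤ.≟ j
  ... | yes ≡.refl = just refl
  ... | no _ = nothing

  open import Algebra.Solver.Ring ℤ.+-*-rawRing (fromCommutativeRing R) homomorphism ≟-coefficients
    public using (solve; _:=_; _:+_; _:*_; _:-_; :-_; con)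

startsOpposite : Bool → List ℕ → Bool
startsOpposite b [] = true
startsOpposite b (y ∷ _) = b xor evenᵇ y

alternating-∷ : ∀ x s → alternating (x ∷ s) ≡ startsOpposite (evenᵇ x) s ∧ alternating s
alternating-∷ x [] = ≡.refl
alternating-∷ x (y ∷ s) with evenᵇ x | evenᵇ y
... | true | true = ≡.refl
... | true | false = ≡.refl
... | false | true = ≡.refl
... | false | false = ≡.refl

xor-not : ∀ b → b xor not b ≡ true
xor-not b = ≡.trans (≡.sym (Boolₚ.not-distribʳ-xor b b)) (≡.cong not (Boolₚ.xor-same b))

parity : ∀ m → ∃[ q ] ((m ≡ suc (2 ℕ.* q) × evenᵇ (suc m) ≡ true × ⌊ suc m /2⌋ ≡ suc q)
                     ⊎ (m ≡ 2 ℕ.* q × evenᵇ (suc m) ≡ false × ⌊ suc m /2⌋ ≡ q))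
parity zero = 0 , inj₂ (≡.refl , ≡.refl , ≡.refl)
parity (suc zero) = 0 , inj₁ (≡.refl , ≡.refl , ≡.refl)
parity (suc (suc m)) with parity m
... | q , inj₁ (m≡ , even , half) =
  suc q , inj₁ (≡.trans (≡.cong (λ n → 2 ℕ.+ n) m≡) (≡.cong suc (≡.sym (ℕₚ.*-suc 2 q))) ,
                ≡.cong (λ b → not (not b)) even , ≡.cong suc half)
... | q , inj₂ (m≡ , even , half) =
  suc q , inj₂ (≡.trans (≡.cong (λ n → 2 ℕ.+ n) m≡) (≡.sym (ℕₚ.*-suc 2 q)) ,
                ≡.cong (λ b → not (not b)) even , ≡.cong suc half)

module _ {c ℓ} (R : CommutativeRing c ℓ) where
  open CommutativeRing R
  open IntegerCoefficients R
  open import Algebra.Properties.Ring ring using (-0#≈0#; -‿involutive; -1*x≈-x)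
  open import Relation.Binary.Reasoning.Setoid setoid
  open import Algebra.Properties.CommutativeSemigroup *-commutativeSemigroup
    using (x∙yz≈y∙xz; xy∙z≈xz∙y)
  open import Algebra.Properties.CommutativeSemigroup +-commutativeSemigroup
    using () renaming (interchange to +-interchange)

  ⟨-1⟩^_ : ℕ → Carrier
  ⟨-1⟩^_ = pow R (- 1#)

  -- cos (n π/2) and sin (n π/2)
  cosQ sinQ : ℕ → Carrier
  cosQ zero = 1#
  cosQ (suc n) = - sinQ n
  sinQ zero = 0#
  sinQ (suc n) = cosQ n

  cosQ-2* : ∀ k → cosQ (2 ℕ.* k) ≈ ⟨-1⟩^ k
  cosQ-2* zero = refl
  cosQ-2* (suc k) = begin
    cosQ (2 ℕ.* suc k)      ≡⟨ ≡.cong cosQ (ℕₚ.*-suc 2 k) ⟩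
    - cosQ (2 ℕ.* k)        ≈⟨ -‿cong (cosQ-2* k) ⟩
    - ⟨-1⟩^ k               ≈⟨ -1*x≈-x _ ⟨
    ⟨-1⟩^ suc k             ∎

  sinQ-2* : ∀ k → sinQ (2 ℕ.* k) ≈ 0#
  sinQ-2* zero = refl
  sinQ-2* (suc k) = begin
    sinQ (2 ℕ.* suc k)      ≡⟨ ≡.cong sinQ (ℕₚ.*-suc 2 k) ⟩
    - sinQ (2 ℕ.* k)        ≈⟨ -‿cong (sinQ-2* k) ⟩
    - 0#                    ≈⟨ -0#≈0# ⟩
    0#                      ∎

  cosQ-∸ : ∀ m j → j ≤ m → cosQ (m ∸ j) ≈ cosQ m * cosQ j + sinQ m * sinQ j
  cosQ-∸ m zero _ = solve 2 (λ c s → c := c :* con (+ 1) :+ s :* con (+ 0)) refl (cosQ m) (sinQ m)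
  cosQ-∸ (suc m) (suc j) (s≤s j≤m) = begin
    cosQ (m ∸ j)                                  ≈⟨ cosQ-∸ m j j≤m ⟩
    cosQ m * cosQ j + sinQ m * sinQ j
      ≈⟨ solve 4 (λ c s c' s' → c :* c' :+ s :* s' := (:- s) :* (:- s') :+ c :* c') refl
               (cosQ m) (sinQ m) (cosQ j) (sinQ j) ⟩
    cosQ (suc m) * cosQ (suc j) + sinQ (suc m) * sinQ (suc j) ∎

  -- altSum b d n o is the sum of cosQ (o + n - |s|) · ∏_{i ∈ s} d i over the sets
  -- s ⊆ {0, …, n-1} whose consecutive elements alternate in parity and whose least
  -- element is even if b and odd otherwise.
  altSum : Bool → (ℕ → Carrier) → ℕ → ℕ → Carrier
  altSum _ d zero o = cosQ o
  altSum true d (suc n) o = d 0 * altSum true (λ i → d (suc i)) n o + altSum false (λ i → d (suc i)) n (suc o)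
  altSum false d (suc n) o = altSum true (λ i → d (suc i)) n (suc o)

  altSum-cong : ∀ b {d e} n o → (∀ i → d i ≈ e i) → altSum b d n o ≈ altSum b e n o
  altSum-cong b zero o _ = refl
  altSum-cong true (suc n) o d≈e =
    +-cong (*-cong (d≈e 0) (altSum-cong true n o (λ i → d≈e (suc i))))
           (altSum-cong false n (suc o) (λ i → d≈e (suc i)))
  altSum-cong false (suc n) o d≈e = altSum-cong true n (suc o) (λ i → d≈e (suc i))

  altSum-+2 : ∀ b d n o → altSum b d n (2 ℕ.+ o) ≈ - altSum b d n o
  altSum-+2 b d zero o = refl
  altSum-+2 true d (suc n) o = begin
    d 0 * altSum true d′ n (2 ℕ.+ o) + altSum false d′ n (3 ℕ.+ o)
      ≈⟨ +-cong (*-congˡ (altSum-+2 true d′ n o)) (altSum-+2 false d′ n (suc o)) ⟩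
    d 0 * - altSum true d′ n o + - altSum false d′ n (suc o)
      ≈⟨ solve 3 (λ a b e → a :* (:- b) :+ (:- e) := :- (a :* b :+ e)) refl (d 0) _ _ ⟩
    - (d 0 * altSum true d′ n o + altSum false d′ n (suc o)) ∎
    where d′ = λ i → d (suc i)
  altSum-+2 false d (suc n) o = altSum-+2 true (λ i → d (suc i)) n (suc o)

  altSum-suc : ∀ b d n o → altSum b d (suc n) o
    ≈ (if b then d 0 * altSum true (λ i → d (suc i)) n o else 0#)
      + altSum (not b) (λ i → d (suc i)) n (suc o)
  altSum-suc true d n o = refl
  altSum-suc false d n o = sym (+-identityˡ _)

  -- The transfer matrix M (d (n-1)) ⋯ M (d 0), M c = [[c, -1], [1, 0]], has the entries
  -- [[altSum true d n 0, altSum false d n 1], [altSum true d n 3, altSum false d n 4]].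
  traceM : (ℕ → Carrier) → ℕ → Carrier
  traceM d n = altSum true d n 0 + altSum false d n 4

  detM≈1 : ∀ d n → altSum true d n 0 * altSum false d n 4 - altSum false d n 1 * altSum true d n 3 ≈ 1#
  detM≈1 d zero =
    solve 0 (con (+ 1) :* (:- (:- con (+ 1))) :- (:- con (+ 0)) :* (:- (:- con (+ 0))) := con (+ 1)) refl
  detM≈1 d (suc n) = begin
    (d 0 * a₀ + b₁) * altSum true d′ n 5 - altSum true d′ n 2 * (d 0 * a₃ + b₄)
      ≈⟨ +-congˡ (-‿cong (*-congʳ (altSum-+2 true d′ n 0))) ⟩
    (d 0 * a₀ + b₁) * altSum true d′ n 5 - (- a₀) * (d 0 * a₃ + b₄)
      ≈⟨ +-congʳ (*-congˡ (altSum-+2 true d′ n 3)) ⟩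
    (d 0 * a₀ + b₁) * (- a₃) - (- a₀) * (d 0 * a₃ + b₄)
      ≈⟨ solve 5 (λ y a₀ a₃ b₁ b₄ → (y :* a₀ :+ b₁) :* (:- a₃) :- (:- a₀) :* (y :* a₃ :+ b₄)
                                  := a₀ :* b₄ :- b₁ :* a₃) refl (d 0) a₀ a₃ b₁ b₄ ⟩
    a₀ * b₄ - b₁ * a₃ ≈⟨ detM≈1 d′ n ⟩
    1# ∎
    where
    d′ = λ i → d (suc i)
    a₀ = altSum true d′ n 0
    a₃ = altSum true d′ n 3
    b₁ = altSum false d′ n 1
    b₄ = altSum false d′ n 4

  transferM : ∀ (d y : ℕ → Carrier) → (∀ l → y (2 ℕ.+ l) ≈ d l * y (suc l) - y l) →
    ∀ n o → altSum true d n o * y 1 + altSum false d n (suc o) * y 0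
              ≈ cosQ o * y (suc n) + cosQ (suc o) * y n
  transferM d y rec zero o = refl
  transferM d y rec (suc n) o = begin
    (d 0 * a + b) * y 1 + altSum true d′ n (2 ℕ.+ o) * y 0
      ≈⟨ +-congˡ (*-congʳ (altSum-+2 true d′ n o)) ⟩
    (d 0 * a + b) * y 1 + (- a) * y 0
      ≈⟨ solve 5 (λ c a b y₁ y₀ → (c :* a :+ b) :* y₁ :+ (:- a) :* y₀
                               := a :* (c :* y₁ :- y₀) :+ b :* y₁) refl (d 0) a b (y 1) (y 0) ⟩
    a * (d 0 * y 1 - y 0) + b * y 1 ≈⟨ +-congʳ (*-congˡ (rec 0)) ⟨
    a * y 2 + b * y 1 ≈⟨ transferM d′ (λ i → y (suc i)) (λ l → rec (suc l)) n o ⟩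
    cosQ o * y (2 ℕ.+ n) + cosQ (suc o) * y (suc n) ∎
    where
    d′ = λ i → d (suc i)
    a = altSum true d′ n o
    b = altSum false d′ n (suc o)

  sumTo-cong : ∀ r {f g} → (∀ k → f k ≈ g k) → sumTo R r f ≈ sumTo R r g
  sumTo-cong zero f≈g = refl
  sumTo-cong (suc r) f≈g = +-cong (sumTo-cong r f≈g) (f≈g r)

  sumTo-head : ∀ r f → sumTo R (suc r) f ≈ f 0 + sumTo R r (λ k → f (suc k))
  sumTo-head zero f = trans (+-identityˡ _) (sym (+-identityʳ _))
  sumTo-head (suc r) f = trans (+-congʳ (sumTo-head r f)) (+-assoc _ _ _)

  sumTo-zero : ∀ r → sumTo R r (λ _ → 0#) ≈ 0#
  sumTo-zero zero = refl
  sumTo-zero (suc r) = trans (+-identityʳ _) (sumTo-zero r)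

  sumTo-*ˡ : ∀ r a f → a * sumTo R r f ≈ sumTo R r (λ k → a * f k)
  sumTo-*ˡ zero a f = zeroʳ a
  sumTo-*ˡ (suc r) a f = trans (distribˡ _ _ _) (+-congʳ (sumTo-*ˡ r a f))

  sumTo-select : ∀ M l F → l < M → sumTo R M (λ j → if l ≡ᵇ j then F j else 0#) ≈ F l
  sumTo-select (suc M) zero F _ = begin
    sumTo R (suc M) (λ j → if 0 ≡ᵇ j then F j else 0#)   ≈⟨ sumTo-head M _ ⟩
    F 0 + sumTo R M (λ _ → 0#)                            ≈⟨ +-congˡ (sumTo-zero M) ⟩
    F 0 + 0#                                              ≈⟨ +-identityʳ _ ⟩
    F 0                                                   ∎
  sumTo-select (suc M) (suc l) F (s≤s l<M) = begin
    sumTo R (suc M) (λ j → if suc l ≡ᵇ j then F j else 0#)    ≈⟨ sumTo-head M _ ⟩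
    0# + sumTo R M (λ j → if l ≡ᵇ j then F (suc j) else 0#)   ≈⟨ +-identityˡ _ ⟩
    sumTo R M (λ j → if l ≡ᵇ j then F (suc j) else 0#)        ≈⟨ sumTo-select M l (λ j → F (suc j)) l<M ⟩
    F (suc l)                                                ∎

  sumTo-pairs : ∀ r f → sumTo R (2 ℕ.* r) f ≈ sumTo R r (λ k → f (2 ℕ.* k) + f (suc (2 ℕ.* k)))
  sumTo-pairs zero f = refl
  sumTo-pairs (suc r) f = begin
    sumTo R (2 ℕ.* suc r) f                       ≡⟨ ≡.cong (λ n → sumTo R n f) (ℕₚ.*-suc 2 r) ⟩
    sumTo R (2 ℕ.* r) f + f (2 ℕ.* r) + f (suc (2 ℕ.* r))
      ≈⟨ +-assoc _ _ _ ⟩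
    sumTo R (2 ℕ.* r) f + (f (2 ℕ.* r) + f (suc (2 ℕ.* r)))
      ≈⟨ +-congʳ (sumTo-pairs r f) ⟩
    sumTo R (suc r) (λ k → f (2 ℕ.* k) + f (suc (2 ℕ.* k))) ∎

  if-cong : ∀ B {u v} → u ≈ v → (if B then u else 0#) ≈ (if B then v else 0#)
  if-cong true u≈v = u≈v
  if-cong false _ = refl

  sumOver : ∀ {a} {A : Set a} → (A → Carrier) → List A → Carrier
  sumOver f [] = 0#
  sumOver f (s ∷ ss) = f s + sumOver f ss

  syntax sumOver (λ s → e) ss = ∑[ s ∈ ss ] e

  module _ {a} {A : Set a} where

    sumOver-++ : ∀ (f : A → Carrier) xs ys → sumOver f (xs ++ ys) ≈ sumOver f xs + sumOver f ys
    sumOver-++ f [] ys = sym (+-identityˡ _)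
    sumOver-++ f (x ∷ xs) ys = trans (+-congˡ (sumOver-++ f xs ys)) (sym (+-assoc _ _ _))

    sumOver-map : ∀ {b} {B : Set b} (f : B → Carrier) (g : A → B) xs →
                  sumOver f (map g xs) ≡ ∑[ x ∈ xs ] f (g x)
    sumOver-map f g [] = ≡.refl
    sumOver-map f g (x ∷ xs) = ≡.cong (_+_ (f (g x))) (sumOver-map f g xs)

    sumOver-+ : ∀ (f g : A → Carrier) xs → sumOver f xs + sumOver g xs ≈ ∑[ x ∈ xs ] (f x + g x)
    sumOver-+ f g [] = +-identityˡ _
    sumOver-+ f g (x ∷ xs) = begin
      f x + sumOver f xs + (g x + sumOver g xs)  ≈⟨ +-interchange _ _ _ _ ⟩
      f x + g x + (sumOver f xs + sumOver g xs) ≈⟨ +-congˡ (sumOver-+ f g xs) ⟩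
      f x + g x + ∑[ x ∈ xs ] (f x + g x)       ∎

    sumOver-*ˡ : ∀ a (f : A → Carrier) xs → a * sumOver f xs ≈ ∑[ x ∈ xs ] (a * f x)
    sumOver-*ˡ a f [] = zeroʳ a
    sumOver-*ˡ a f (x ∷ xs) = trans (distribˡ _ _ _) (+-congˡ (sumOver-*ˡ a f xs))

    sumOver-zero : ∀ (xs : List A) → ∑[ x ∈ xs ] 0# ≈ 0#
    sumOver-zero [] = refl
    sumOver-zero (x ∷ xs) = trans (+-identityˡ _) (sumOver-zero xs)

    sumOver-if : ∀ B a (f : A → Carrier) xs →
      ∑[ x ∈ xs ] (if B then a * f x else 0#) ≈ (if B then a * sumOver f xs else 0#)
    sumOver-if true a f xs = sym (sumOver-*ˡ a f xs)
    sumOver-if false a f xs = sumOver-zero xs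

    sumTo-sumOver : ∀ r (f : ℕ → A → Carrier) xs →
                    sumTo R r (λ k → sumOver (f k) xs) ≈ ∑[ x ∈ xs ] sumTo R r (λ k → f k x)
    sumTo-sumOver zero f xs = sym (sumOver-zero xs)
    sumTo-sumOver (suc r) f xs =
      trans (+-congʳ (sumTo-sumOver r f xs)) (sumOver-+ _ (f r) xs)

    foldr-filterᵇ : ∀ (w : A → Carrier) p xs →
      foldr _+_ 0# (map w (filterᵇ p xs)) ≈ ∑[ x ∈ xs ] (if p x then w x else 0#)
    foldr-filterᵇ w p [] = refl
    foldr-filterᵇ w p (x ∷ xs) with p x
    ... | true = +-congˡ (foldr-filterᵇ w p xs)
    ... | false = trans (foldr-filterᵇ w p xs) (sym (+-identityˡ _))

  sublists-∷ : ∀ (f : List ℕ → Carrier) x xs →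
    sumOver f (sublists (x ∷ xs)) ≈ ∑[ s ∈ sublists xs ] f (x ∷ s) + sumOver f (sublists xs)
  sublists-∷ f x xs = trans (sumOver-++ f (map (x ∷_) (sublists xs)) (sublists xs))
                            (+-congʳ (reflexive (sumOver-map f (x ∷_) (sublists xs))))

  sublists-cong : ∀ xs {f g : List ℕ → Carrier} → (∀ s → length s ≤ length xs → f s ≈ g s) →
                  sumOver f (sublists xs) ≈ sumOver g (sublists xs)
  sublists-cong [] f≈g = +-congʳ (f≈g [] z≤n)
  sublists-cong (x ∷ xs) {f} {g} f≈g = begin
    sumOver f (sublists (x ∷ xs))                                  ≈⟨ sublists-∷ f x xs ⟩
    ∑[ s ∈ sublists xs ] f (x ∷ s) + sumOver f (sublists xs)
      ≈⟨ +-cong (sublists-cong xs (λ s l → f≈g (x ∷ s) (s≤s l)))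
                (sublists-cong xs (λ s l → f≈g s (ℕₚ.m≤n⇒m≤1+n l))) ⟩
    ∑[ s ∈ sublists xs ] g (x ∷ s) + sumOver g (sublists xs)        ≈⟨ sublists-∷ g x xs ⟨
    sumOver g (sublists (x ∷ xs))                                  ∎

  sublists-cong-nonempty : ∀ xs {f g : List ℕ → Carrier} →
    (∀ s → 1 ≤ length s → length s ≤ length xs → f s ≈ g s) →
    sumOver f (sublists xs) + g [] ≈ sumOver g (sublists xs) + f []
  sublists-cong-nonempty [] {f} {g} _ =
    solve 2 (λ a b → (a :+ con (+ 0)) :+ b := (b :+ con (+ 0)) :+ a) refl (f []) (g [])
  sublists-cong-nonempty (x ∷ xs) {f} {g} f≈g = begin
    sumOver f (sublists (x ∷ xs)) + g []                           ≈⟨ +-congʳ (sublists-∷ f x xs) ⟩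
    ∑[ s ∈ sublists xs ] f (x ∷ s) + sumOver f (sublists xs) + g [] ≈⟨ +-assoc _ _ _ ⟩
    ∑[ s ∈ sublists xs ] f (x ∷ s) + (sumOver f (sublists xs) + g [])
      ≈⟨ +-cong (sublists-cong xs (λ s l → f≈g (x ∷ s) (s≤s z≤n) (s≤s l)))
                (sublists-cong-nonempty xs (λ s l l′ → f≈g s l (ℕₚ.m≤n⇒m≤1+n l′))) ⟩
    ∑[ s ∈ sublists xs ] g (x ∷ s) + (sumOver g (sublists xs) + f []) ≈⟨ +-assoc _ _ _ ⟨
    ∑[ s ∈ sublists xs ] g (x ∷ s) + sumOver g (sublists xs) + f [] ≈⟨ +-congʳ (sublists-∷ g x xs) ⟨
    sumOver g (sublists (x ∷ xs)) + f []                           ∎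

  module _ (γ : ℕ → Carrier) where

    product : List ℕ → Carrier
    product s = foldr _*_ 1# (map γ s)

    -- the term of s in altSum≈sublists below; b is the parity the least element of s must avoid
    altTerm : Bool → ℕ → ℕ → List ℕ → Carrier
    altTerm b n o s =
      if startsOpposite b s ∧ alternating s then cosQ (o ℕ.+ (n ∸ length s)) * product s else 0#

    altTerm₀ : ℕ → List ℕ → Carrier
    altTerm₀ n s = if alternating s then cosQ (n ∸ length s) * product s else 0#

    altTermSum : ℕ → Carrier
    altTermSum n = ∑[ s ∈ sublists (range1 n) ] altTerm₀ n s

    altTerm-∷ : ∀ b n o x s →
      altTerm b (suc n) o (x ∷ s) ≈ (if b xor evenᵇ x then γ x * altTerm (evenᵇ x) n o s else 0#)
    altTerm-∷ b n o x s rewrite alternating-∷ x s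
      with b xor evenᵇ x | startsOpposite (evenᵇ x) s ∧ alternating s
    ... | true | true = x∙yz≈y∙xz _ _ _
    ... | true | false = sym (zeroʳ _)
    ... | false | _ = refl

    altTerm-suc : ∀ b n o s → length s ≤ n → altTerm b (suc n) o s ≡ altTerm b n (suc o) s
    altTerm-suc b n o s |s|≤n =
      ≡.cong (λ k → if startsOpposite b s ∧ alternating s then cosQ k * product s else 0#)
             (≡.trans (≡.cong (o ℕ.+_) (ℕₚ.+-∸-assoc 1 |s|≤n)) (ℕₚ.+-suc o (n ∸ length s)))

    altSum≈sublists : ∀ f → (∀ i → f (suc i) ≡ suc (f i)) → ∀ n b o →
      ∑[ s ∈ sublists (applyUpTo f n) ] altTerm b n o s ≈ altSum (b xor evenᵇ (f 0)) (λ i → γ (f i)) n o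
    altSum≈sublists f f-suc zero b o =
      trans (+-identityʳ _) (trans (*-identityʳ _) (reflexive (≡.cong cosQ (ℕₚ.+-identityʳ o))))
    altSum≈sublists f f-suc (suc n) b o = begin
      ∑[ s ∈ sublists (f 0 ∷ L) ] altTerm b (suc n) o s
        ≈⟨ sublists-∷ _ (f 0) L ⟩
      ∑[ s ∈ sublists L ] altTerm b (suc n) o (f 0 ∷ s) + ∑[ s ∈ sublists L ] altTerm b (suc n) o s
        ≈⟨ +-cong (sublists-cong L (λ s _ → altTerm-∷ b n o (f 0) s))
                  (sublists-cong L (λ s l → reflexive (altTerm-suc b n o s (≤-length l)))) ⟩
      ∑[ s ∈ sublists L ] (if b xor e₀ then γ (f 0) * altTerm e₀ n o s else 0#)
        + ∑[ s ∈ sublists L ] altTerm b n (suc o) s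
        ≈⟨ +-cong (sumOver-if (b xor e₀) (γ (f 0)) (altTerm e₀ n o) (sublists L))
                  (altSum≈sublists f′ f′-suc n b (suc o)) ⟩
      (if b xor e₀ then γ (f 0) * ∑[ s ∈ sublists L ] altTerm e₀ n o s else 0#)
        + altSum (b xor evenᵇ (f 1)) d′ n (suc o)
        ≈⟨ +-cong (if-cong (b xor e₀) (*-congˡ (altSum≈sublists f′ f′-suc n e₀ o)))
                  (reflexive (≡.cong (λ b′ → altSum b′ d′ n (suc o)) flip)) ⟩
      (if b xor e₀ then γ (f 0) * altSum (e₀ xor evenᵇ (f 1)) d′ n o else 0#)
        + altSum (not (b xor e₀)) d′ n (suc o)
        ≈⟨ +-congʳ (if-cong (b xor e₀)
                     (*-congˡ (reflexive (≡.cong (λ b′ → altSum b′ d′ n o) alternates)))) ⟩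
      (if b xor e₀ then γ (f 0) * altSum true d′ n o else 0#) + altSum (not (b xor e₀)) d′ n (suc o)
        ≈⟨ altSum-suc (b xor e₀) (λ i → γ (f i)) n o ⟨
      altSum (b xor e₀) (λ i → γ (f i)) (suc n) o ∎
      where
      f′ = λ i → f (suc i)
      f′-suc : ∀ i → f′ (suc i) ≡ suc (f′ i)
      f′-suc i = f-suc (suc i)
      L = applyUpTo f′ n
      d′ = λ i → γ (f′ i)
      e₀ = evenᵇ (f 0)
      ≤-length : ∀ {k} → k ≤ length L → k ≤ n
      ≤-length k≤ = ≡.subst (_ ≤_) (Listₚ.length-applyUpTo f′ n) k≤
      even-f₁ : evenᵇ (f 1) ≡ not e₀
      even-f₁ = ≡.cong evenᵇ (f-suc 0)
      flip : b xor evenᵇ (f 1) ≡ not (b xor e₀)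
      flip = ≡.trans (≡.cong (b xor_) even-f₁) (≡.sym (Boolₚ.not-distribʳ-xor b e₀))
      alternates : e₀ xor evenᵇ (f 1) ≡ true
      alternates = ≡.trans (≡.cong (e₀ xor_) even-f₁) (xor-not e₀)

    traceM≈altTermSum : ∀ n → traceM (λ i → γ (suc i)) n ≈ altTermSum n + cosQ n
    traceM≈altTermSum n = begin
      altSum true d n 0 + altSum false d n 4
        ≈⟨ +-congˡ (trans (altSum-+2 false d n 2)
                          (trans (-‿cong (altSum-+2 false d n 0)) (-‿involutive _))) ⟩
      altSum true d n 0 + altSum false d n 0
        ≈⟨ +-cong (altSum≈sublists suc (λ _ → ≡.refl) n true 0)
                  (altSum≈sublists suc (λ _ → ≡.refl) n false 0) ⟨
      ∑[ s ∈ sublists L ] altTerm true n 0 s + ∑[ s ∈ sublists L ] altTerm false n 0 s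
        ≈⟨ sumOver-+ _ _ (sublists L) ⟩
      ∑[ s ∈ sublists L ] both s
        ≈⟨ solve 2 (λ q c → q := (q :+ c :* con (+ 1)) :- c :* con (+ 1)) refl
                 (sumOver both (sublists L)) (cosQ n) ⟩
      ∑[ s ∈ sublists L ] both s + cosQ n * 1# - cosQ n * 1#
        ≈⟨ +-congʳ (sublists-cong-nonempty L (λ s 1≤|s| _ → sym (both≈altTerm₀ s 1≤|s|))) ⟨
      ∑[ s ∈ sublists L ] altTerm₀ n s + (cosQ n * 1# + cosQ n * 1#) - cosQ n * 1#
        ≈⟨ solve 2 (λ q c → (q :+ (c :* con (+ 1) :+ c :* con (+ 1))) :- c :* con (+ 1) := q :+ c) refl
                 (sumOver (altTerm₀ n) (sublists L)) (cosQ n) ⟩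
      ∑[ s ∈ sublists L ] altTerm₀ n s + cosQ n
        ≡⟨ ≡.cong (λ L′ → sumOver (altTerm₀ n) (sublists L′) + cosQ n) (Listₚ.map-applyUpTo id suc n) ⟨
      altTermSum n + cosQ n ∎
      where
      d = λ i → γ (suc i)
      L = applyUpTo suc n
      both : List ℕ → Carrier
      both s = altTerm true n 0 s + altTerm false n 0 s
      -- a nonempty set starts with an element of exactly one parity
      both≈altTerm₀ : ∀ s → 1 ≤ length s → both s ≈ altTerm₀ n s
      both≈altTerm₀ (y ∷ s) _ with evenᵇ y
      ... | true = +-identityˡ _
      ... | false = +-identityʳ _

    -- tAlt with the empty set counted once: tAlt′ m 0 = 1 where tAlt γ m 0 = 2
    tAlt′ : ℕ → ℕ → Carrier
    tAlt′ m j = ∑[ s ∈ sublists (range1 m) ] (if (length s ≡ᵇ j) ∧ alternating s then product s else 0#)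

    tAlt≈tAlt′ : ∀ m j → tAlt R γ m (suc j) ≈ tAlt′ m (suc j)
    tAlt≈tAlt′ m j = foldr-filterᵇ product _ (sublists (range1 m))

    tAlt′-zero : ∀ m → tAlt′ m 0 ≈ 1#
    tAlt′-zero m = go (range1 m)
      where
      go : ∀ L → ∑[ s ∈ sublists L ] (if (length s ≡ᵇ 0) ∧ alternating s then product s else 0#) ≈ 1#
      go [] = +-identityʳ 1#
      go (x ∷ L) = begin
        _ ≈⟨ sublists-∷ _ x L ⟩
        ∑[ s ∈ sublists L ] 0# + _ ≈⟨ +-cong (sumOver-zero (sublists L)) (go L) ⟩
        0# + 1#                     ≈⟨ +-identityˡ 1# ⟩
        1#                          ∎

    sublists-byLength : ∀ L M (F : ℕ → Carrier) → length L < M →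
      ∑[ s ∈ sublists L ] (if alternating s then F (length s) * product s else 0#)
        ≈ sumTo R M (λ j → F j *
            ∑[ s ∈ sublists L ] (if (length s ≡ᵇ j) ∧ alternating s then product s else 0#))
    sublists-byLength L M F |L|<M = sym (begin
      sumTo R M (λ j → F j * sumOver (P j) (sublists L))
        ≈⟨ sumTo-cong M (λ j → sumOver-*ˡ (F j) (P j) (sublists L)) ⟩
      sumTo R M (λ j → ∑[ s ∈ sublists L ] (F j * P j s))
        ≈⟨ sumTo-sumOver M (λ j s → F j * P j s) (sublists L) ⟩
      ∑[ s ∈ sublists L ] sumTo R M (λ j → F j * P j s)
        ≈⟨ sublists-cong L (λ s |s|≤|L| → begin
             sumTo R M (λ j → F j * P j s)
               ≈⟨ sumTo-cong M (λ j → *-if-∧ (length s ≡ᵇ j) (alternating s) (F j) (product s)) ⟩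
             sumTo R M (λ j → if length s ≡ᵇ j then F j * (if alternating s then product s else 0#) else 0#)
               ≈⟨ sumTo-select M (length s) _ (ℕₚ.≤-<-trans |s|≤|L| |L|<M) ⟩
             F (length s) * (if alternating s then product s else 0#)
               ≈⟨ *-if (alternating s) (F (length s)) (product s) ⟩
             (if alternating s then F (length s) * product s else 0#) ∎) ⟩
      ∑[ s ∈ sublists L ] (if alternating s then F (length s) * product s else 0#) ∎)
      where
      P : ℕ → List ℕ → Carrier
      P j s = if (length s ≡ᵇ j) ∧ alternating s then product s else 0#
      *-if : ∀ B u p → u * (if B then p else 0#) ≈ (if B then u * p else 0#)
      *-if true u p = refl
      *-if false u p = zeroʳ u
      *-if-∧ : ∀ B A u p → u * (if B ∧ A then p else 0#) ≈ (if B then u * (if A then p else 0#) else 0#)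
      *-if-∧ true A u p = refl
      *-if-∧ false A u p = zeroʳ u

    altTermSum-byParity : ∀ m r → m < 2 ℕ.* r →
      altTermSum m
        ≈ sumTo R r (λ k → ⟨-1⟩^ k * (cosQ m * tAlt′ m (2 ℕ.* k) + sinQ m * tAlt′ m (suc (2 ℕ.* k))))
    altTermSum-byParity m r m<2r = begin
      ∑[ s ∈ sublists L ] altTerm₀ m s
        ≈⟨ sublists-cong L (λ s |s|≤|L| → if-cong (alternating s)
             (*-congʳ (cosQ-∸ m (length s) (≡.subst (_ ≤_) |L|≡m |s|≤|L|)))) ⟩
      ∑[ s ∈ sublists L ] (if alternating s then F (length s) * product s else 0#)
        ≈⟨ sublists-byLength L (2 ℕ.* r) F (≡.subst (_< 2 ℕ.* r) (≡.sym |L|≡m) m<2r) ⟩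
      sumTo R (2 ℕ.* r) (λ j → F j * tAlt′ m j)
        ≈⟨ sumTo-pairs r _ ⟩
      sumTo R r (λ k → F (2 ℕ.* k) * tAlt′ m (2 ℕ.* k) + F (suc (2 ℕ.* k)) * tAlt′ m (suc (2 ℕ.* k)))
        ≈⟨ sumTo-cong r pair ⟩
      sumTo R r (λ k → ⟨-1⟩^ k * (cosQ m * tAlt′ m (2 ℕ.* k) + sinQ m * tAlt′ m (suc (2 ℕ.* k)))) ∎
      where
      L = range1 m
      |L|≡m : length L ≡ m
      |L|≡m = ≡.trans (Listₚ.length-map suc (upTo m)) (Listₚ.length-upTo m)
      F : ℕ → Carrier
      F j = cosQ m * cosQ j + sinQ m * sinQ j
      pair : ∀ k → F (2 ℕ.* k) * tAlt′ m (2 ℕ.* k) + F (suc (2 ℕ.* k)) * tAlt′ m (suc (2 ℕ.* k))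
                 ≈ ⟨-1⟩^ k * (cosQ m * tAlt′ m (2 ℕ.* k) + sinQ m * tAlt′ m (suc (2 ℕ.* k)))
      pair k = begin
        (cosQ m * cosQ (2 ℕ.* k) + sinQ m * sinQ (2 ℕ.* k)) * A₀
          + (cosQ m * - sinQ (2 ℕ.* k) + sinQ m * cosQ (2 ℕ.* k)) * A₁
          ≈⟨ +-cong (*-congʳ (+-cong (*-congˡ (cosQ-2* k)) (*-congˡ (sinQ-2* k))))
                    (*-congʳ (+-cong (*-congˡ (-‿cong (sinQ-2* k))) (*-congˡ (cosQ-2* k)))) ⟩
        (cosQ m * ⟨-1⟩^ k + sinQ m * 0#) * A₀ + (cosQ m * - 0# + sinQ m * ⟨-1⟩^ k) * A₁
          ≈⟨ solve 5 (λ c s p a₀ a₁ → (c :* p :+ s :* con (+ 0)) :* a₀ :+ (c :* (:- con (+ 0)) :+ s :* p) :* a₁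
                                   := p :* (c :* a₀ :+ s :* a₁)) refl (cosQ m) (sinQ m) (⟨-1⟩^ k) A₀ A₁ ⟩
        ⟨-1⟩^ k * (cosQ m * A₀ + sinQ m * A₁) ∎
        where
        A₀ = tAlt′ m (2 ℕ.* k)
        A₁ = tAlt′ m (suc (2 ℕ.* k))

    sumTo-tAlt-even : ∀ m q → sumTo R (suc q) (λ k → ⟨-1⟩^ k * tAlt R γ m (2 ℕ.* k))
                                ≈ sumTo R (suc q) (λ k → ⟨-1⟩^ k * tAlt′ m (2 ℕ.* k)) + 1#
    sumTo-tAlt-even m q = begin
      sumTo R (suc q) (λ k → ⟨-1⟩^ k * tAlt R γ m (2 ℕ.* k))
        ≈⟨ sumTo-head q _ ⟩
      1# * (1# + 1#) + sumTo R q (λ k → ⟨-1⟩^ suc k * tAlt R γ m (2 ℕ.* suc k))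
        ≈⟨ +-cong (*-congˡ (+-congʳ (sym (tAlt′-zero m))))
                  (sumTo-cong q (λ k → *-congˡ (tAlt≈tAlt′-2* k))) ⟩
      1# * (tAlt′ m 0 + 1#) + sumTo R q (λ k → ⟨-1⟩^ suc k * tAlt′ m (2 ℕ.* suc k))
        ≈⟨ solve 2 (λ a s → con (+ 1) :* (a :+ con (+ 1)) :+ s := (con (+ 1) :* a :+ s) :+ con (+ 1)) refl
                 (tAlt′ m 0) (sumTo R q (λ k → ⟨-1⟩^ suc k * tAlt′ m (2 ℕ.* suc k))) ⟩
      1# * tAlt′ m 0 + sumTo R q (λ k → ⟨-1⟩^ suc k * tAlt′ m (2 ℕ.* suc k)) + 1#
        ≈⟨ +-congʳ (sumTo-head q _) ⟨
      sumTo R (suc q) (λ k → ⟨-1⟩^ k * tAlt′ m (2 ℕ.* k)) + 1# ∎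
      where
      tAlt≈tAlt′-2* : ∀ k → tAlt R γ m (2 ℕ.* suc k) ≈ tAlt′ m (2 ℕ.* suc k)
      tAlt≈tAlt′-2* k rewrite ℕₚ.*-suc 2 k = tAlt≈tAlt′ m (suc (2 ℕ.* k))

    -- the two branches of S₁, definitionally those of its where-block
    S₁-even S₁-odd : ℕ → Carrier
    S₁-even r = ⟨-1⟩^ (r ∸ 1) * sumTo R r (λ k → ⟨-1⟩^ k * tAlt R γ (2 ℕ.* r ∸ 1) (suc (2 ℕ.* k)))
    S₁-odd r = ⟨-1⟩^ (r ∸ 1) * sumTo R r (λ k → ⟨-1⟩^ k * tAlt R γ (2 ℕ.* r ∸ 2) (2 ℕ.* k))

    S₁-even≈ : ∀ q → S₁-even (suc q) ≈ altTermSum (suc (2 ℕ.* q)) + cosQ (suc (2 ℕ.* q))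
    S₁-even≈ q = begin
      ⟨-1⟩^ q * sumTo R (suc q) (λ k → ⟨-1⟩^ k * tAlt R γ (2 ℕ.* suc q ∸ 1) (suc (2 ℕ.* k)))
        ≡⟨ ≡.cong (λ m′ → ⟨-1⟩^ q * sumTo R (suc q) (λ k → ⟨-1⟩^ k * tAlt R γ m′ (suc (2 ℕ.* k))))
                  (≡.cong (_∸ 1) (ℕₚ.*-suc 2 q)) ⟩
      ⟨-1⟩^ q * sumTo R (suc q) (λ k → ⟨-1⟩^ k * tAlt R γ m (suc (2 ℕ.* k)))
        ≈⟨ sumTo-*ˡ (suc q) _ _ ⟩
      sumTo R (suc q) (λ k → ⟨-1⟩^ q * (⟨-1⟩^ k * tAlt R γ m (suc (2 ℕ.* k))))
        ≈⟨ sumTo-cong (suc q) term ⟩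
      sumTo R (suc q) (λ k → ⟨-1⟩^ k * (cosQ m * tAlt′ m (2 ℕ.* k) + sinQ m * tAlt′ m (suc (2 ℕ.* k))))
        ≈⟨ altTermSum-byParity m (suc q) (ℕₚ.≤-reflexive (≡.sym (ℕₚ.*-suc 2 q))) ⟨
      altTermSum m
        ≈⟨ +-identityʳ _ ⟨
      altTermSum m + 0#
        ≈⟨ +-congˡ cosQ-m≈0 ⟨
      altTermSum m + cosQ m ∎
      where
      m = suc (2 ℕ.* q)
      cosQ-m≈0 : cosQ m ≈ 0#
      cosQ-m≈0 = trans (-‿cong (sinQ-2* q)) -0#≈0#
      term : ∀ k → ⟨-1⟩^ q * (⟨-1⟩^ k * tAlt R γ m (suc (2 ℕ.* k)))
                   ≈ ⟨-1⟩^ k * (cosQ m * tAlt′ m (2 ℕ.* k) + sinQ m * tAlt′ m (suc (2 ℕ.* k)))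
      term k = begin
        ⟨-1⟩^ q * (⟨-1⟩^ k * tAlt R γ m (suc (2 ℕ.* k)))
          ≈⟨ *-congˡ (*-congˡ (tAlt≈tAlt′ m (2 ℕ.* k))) ⟩
        ⟨-1⟩^ q * (⟨-1⟩^ k * tAlt′ m (suc (2 ℕ.* k)))
          ≈⟨ solve 4 (λ p p′ a₀ a₁ → p′ :* (p :* a₁) := p :* (con (+ 0) :* a₀ :+ p′ :* a₁)) refl
                   (⟨-1⟩^ k) (⟨-1⟩^ q) (tAlt′ m (2 ℕ.* k)) (tAlt′ m (suc (2 ℕ.* k))) ⟩
        ⟨-1⟩^ k * (0# * tAlt′ m (2 ℕ.* k) + ⟨-1⟩^ q * tAlt′ m (suc (2 ℕ.* k)))
          ≈⟨ *-congˡ (+-cong (*-congʳ (sym cosQ-m≈0)) (*-congʳ (sym (cosQ-2* q)))) ⟩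
        ⟨-1⟩^ k * (cosQ m * tAlt′ m (2 ℕ.* k) + sinQ m * tAlt′ m (suc (2 ℕ.* k))) ∎

    S₁-odd≈ : ∀ q → S₁-odd (suc q) ≈ altTermSum (2 ℕ.* q) + cosQ (2 ℕ.* q)
    S₁-odd≈ q = begin
      ⟨-1⟩^ q * sumTo R (suc q) (λ k → ⟨-1⟩^ k * tAlt R γ (2 ℕ.* suc q ∸ 2) (2 ℕ.* k))
        ≡⟨ ≡.cong (λ m′ → ⟨-1⟩^ q * sumTo R (suc q) (λ k → ⟨-1⟩^ k * tAlt R γ m′ (2 ℕ.* k)))
                  (≡.cong (_∸ 2) (ℕₚ.*-suc 2 q)) ⟩
      ⟨-1⟩^ q * sumTo R (suc q) (λ k → ⟨-1⟩^ k * tAlt R γ m (2 ℕ.* k))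
        ≈⟨ *-congˡ (sumTo-tAlt-even m q) ⟩
      ⟨-1⟩^ q * (sumTo R (suc q) (λ k → ⟨-1⟩^ k * tAlt′ m (2 ℕ.* k)) + 1#)
        ≈⟨ distribˡ _ _ _ ⟩
      ⟨-1⟩^ q * sumTo R (suc q) (λ k → ⟨-1⟩^ k * tAlt′ m (2 ℕ.* k)) + ⟨-1⟩^ q * 1#
        ≈⟨ +-cong (sumTo-*ˡ (suc q) _ _) (trans (*-identityʳ _) (sym (cosQ-2* q))) ⟩
      sumTo R (suc q) (λ k → ⟨-1⟩^ q * (⟨-1⟩^ k * tAlt′ m (2 ℕ.* k))) + cosQ m
        ≈⟨ +-congʳ (sumTo-cong (suc q) term) ⟩
      sumTo R (suc q) (λ k → ⟨-1⟩^ k * (cosQ m * tAlt′ m (2 ℕ.* k) + sinQ m * tAlt′ m (suc (2 ℕ.* k))))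
        + cosQ m
        ≈⟨ +-congʳ (altTermSum-byParity m (suc q) m<2+m) ⟨
      altTermSum m + cosQ m ∎
      where
      m = 2 ℕ.* q
      m<2+m : m < 2 ℕ.* suc q
      m<2+m = ≡.subst (suc m ≤_) (≡.sym (ℕₚ.*-suc 2 q)) (ℕₚ.n≤1+n (suc m))
      term : ∀ k → ⟨-1⟩^ q * (⟨-1⟩^ k * tAlt′ m (2 ℕ.* k))
                   ≈ ⟨-1⟩^ k * (cosQ m * tAlt′ m (2 ℕ.* k) + sinQ m * tAlt′ m (suc (2 ℕ.* k)))
      term k = begin
        ⟨-1⟩^ q * (⟨-1⟩^ k * tAlt′ m (2 ℕ.* k))
          ≈⟨ solve 4 (λ p p′ a₀ a₁ → p′ :* (p :* a₀) := p :* (p′ :* a₀ :+ con (+ 0) :* a₁)) refl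
                   (⟨-1⟩^ k) (⟨-1⟩^ q) (tAlt′ m (2 ℕ.* k)) (tAlt′ m (suc (2 ℕ.* k))) ⟩
        ⟨-1⟩^ k * (⟨-1⟩^ q * tAlt′ m (2 ℕ.* k) + 0# * tAlt′ m (suc (2 ℕ.* k)))
          ≈⟨ *-congˡ (+-cong (*-congʳ (sym (cosQ-2* q))) (*-congʳ (sym (sinQ-2* q)))) ⟩
        ⟨-1⟩^ k * (cosQ m * tAlt′ m (2 ℕ.* k) + sinQ m * tAlt′ m (suc (2 ℕ.* k))) ∎

    S₁≈traceM : ∀ m → S₁ R γ (suc m) ≈ traceM (λ i → γ (suc i)) m
    S₁≈traceM m with parity m
    ... | q , inj₁ (≡.refl , even , half) = begin
      S₁ R γ (suc m)     ≡⟨ ≡.cong₂ (λ b h → if b then S₁-even h else S₁-odd (suc h)) even half ⟩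
      S₁-even (suc q)    ≈⟨ S₁-even≈ q ⟩
      _                  ≈⟨ traceM≈altTermSum m ⟨
      traceM (λ i → γ (suc i)) m ∎
    ... | q , inj₂ (≡.refl , odd , half) = begin
      S₁ R γ (suc m)     ≡⟨ ≡.cong₂ (λ b h → if b then S₁-even h else S₁-odd (suc h)) odd half ⟩
      S₁-odd (suc q)     ≈⟨ S₁-odd≈ q ⟩
      _                  ≈⟨ traceM≈altTermSum m ⟨
      traceM (λ i → γ (suc i)) m ∎

  equal-differences : ∀ {a b e f z} → a ≈ b + z → e ≈ f + z → a + f ≈ b + e
  equal-differences {a} {b} {e} {f} {z} a≈b+z e≈f+z = begin
    a + f        ≈⟨ +-congʳ a≈b+z ⟩
    b + z + f    ≈⟨ solve 3 (λ b f z → b :+ z :+ f := b :+ (f :+ z)) refl b f z ⟩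
    b + (f + z)  ≈⟨ +-congˡ e≈f+z ⟨
    b + e        ∎

  cross-multiplication : ∀ {a b d e i j} → a * d ≈ b * e → b * i ≈ 1# → d * j ≈ 1# → a * i ≈ e * j
  cross-multiplication {a} {b} {d} {e} {i} {j} ad≈be bi≈1 dj≈1 = begin
    a * i                ≈⟨ *-identityʳ _ ⟨
    a * i * 1#           ≈⟨ *-congˡ dj≈1 ⟨
    a * i * (d * j)      ≈⟨ solve 4 (λ a i d j → a :* i :* (d :* j) := a :* d :* (i :* j)) refl a i d j ⟩
    a * d * (i * j)      ≈⟨ *-congʳ ad≈be ⟩
    b * e * (i * j)      ≈⟨ solve 4 (λ b e i j → b :* e :* (i :* j) := e :* j :* (b :* i)) refl b e i j ⟩
    e * j * (b * i)      ≈⟨ *-congˡ bi≈1 ⟩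
    e * j * 1#           ≈⟨ *-identityʳ _ ⟩
    e * j                ∎

  *-cancelʳ-invertible : ∀ {a b u v} → a * u ≈ b * u → u * v ≈ 1# → a ≈ b
  *-cancelʳ-invertible {a} {b} {u} {v} au≈bu uv≈1 = begin
    a              ≈⟨ *-identityʳ a ⟨
    a * 1#         ≈⟨ *-congˡ uv≈1 ⟨
    a * (u * v)    ≈⟨ *-assoc a u v ⟨
    a * u * v      ≈⟨ *-congʳ au≈bu ⟩
    b * u * v      ≈⟨ *-assoc b u v ⟩
    b * (u * v)    ≈⟨ *-congˡ uv≈1 ⟩
    b * 1#         ≈⟨ *-identityʳ b ⟩
    b              ∎

  cSeq-recurrence : ∀ (x inv : ℕ → Carrier) l → x (suc l) * inv (suc l) ≈ 1# →
                    x (2 ℕ.+ l) ≈ cSeq R x inv l * x (suc l) - x l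
  cSeq-recurrence x inv l x-inv = begin
    x (2 ℕ.+ l)                                  ≈⟨ solve 2 (λ a b → a := (b :+ a) :* con (+ 1) :- b) refl _ _ ⟩
    (x l + x (2 ℕ.+ l)) * 1# - x l               ≈⟨ +-congʳ (*-congˡ x-inv) ⟨
    (x l + x (2 ℕ.+ l)) * (x (suc l) * inv (suc l)) - x l
      ≈⟨ solve 4 (λ s y i b → s :* (y :* i) :- b := s :* i :* y :- b) refl _ _ _ _ ⟩
    cSeq R x inv l * x (suc l) - x l             ∎

  module _ (x inv : ℕ → Carrier) (m : ℕ)
           (x-inv : ∀ n → 1 ≤ n → x n * inv n ≈ 1#)
           (somos : ∀ n → 1 ≤ n → x n * x (n ℕ.+ suc m) ≈ x (suc n) * x (n ℕ.+ m) + 1#) where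

    private
      γ : ℕ → Carrier
      γ = cSeq R x inv

      d : ℕ → Carrier
      d i = γ (suc i)

      x-cong : ∀ {i j} → i ≡ j → x i ≈ x j
      x-cong i≡j = reflexive (≡.cong x i≡j)

      linear-recurrence : ∀ l → x (3 ℕ.+ l) ≈ γ (suc l) * x (2 ℕ.+ l) - x (suc l)
      linear-recurrence l = cSeq-recurrence x inv (suc l) (x-inv (2 ℕ.+ l) (s≤s z≤n))

    cSeq-periodic : ∀ l → 1 ≤ l → γ (l ℕ.+ m) ≈ γ l
    cSeq-periodic l 1≤l =
      sym (cross-multiplication cross (x-inv (suc l) (s≤s z≤n)) (x-inv (suc (l ℕ.+ m)) (s≤s z≤n)))
      where
      cross : (x l + x (2 ℕ.+ l)) * x (suc (l ℕ.+ m)) ≈ x (suc l) * (x (l ℕ.+ m) + x (2 ℕ.+ (l ℕ.+ m)))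
      cross = begin
        (x l + x (2 ℕ.+ l)) * x (suc (l ℕ.+ m))
          ≈⟨ distribʳ _ _ _ ⟩
        x l * x (suc (l ℕ.+ m)) + x (2 ℕ.+ l) * x (suc (l ℕ.+ m))
          ≈⟨ equal-differences
               (trans (*-congˡ (x-cong (≡.sym (ℕₚ.+-suc l m)))) (somos l 1≤l))
               (trans (*-congˡ (x-cong (≡.cong suc (≡.sym (ℕₚ.+-suc l m))))) (somos (suc l) (s≤s z≤n))) ⟩
        x (suc l) * x (l ℕ.+ m) + x (suc l) * x (2 ℕ.+ (l ℕ.+ m))
          ≈⟨ distribˡ _ _ _ ⟨
        x (suc l) * (x (l ℕ.+ m) + x (2 ℕ.+ (l ℕ.+ m))) ∎

    private
      p₁₁ p₁₂ p₂₁ p₂₂ : Carrier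
      p₁₁ = altSum true d m 0
      p₁₂ = altSum false d m 1
      p₂₁ = altSum true d m 3
      p₂₂ = altSum false d m 4

    first-period : ∀ o → altSum true d m o * x 2 + altSum false d m (suc o) * x 1
                           ≈ cosQ o * x (2 ℕ.+ m) + cosQ (suc o) * x (1 ℕ.+ m)
    first-period = transferM d (λ i → x (suc i)) linear-recurrence m

    first-period-row₁ : x (2 ℕ.+ m) ≈ p₁₁ * x 2 + p₁₂ * x 1
    first-period-row₁ = sym (trans (first-period 0)
      (solve 2 (λ z y → con (+ 1) :* z :+ (:- con (+ 0)) :* y := z) refl (x (2 ℕ.+ m)) (x (1 ℕ.+ m))))

    first-period-row₂ : x (1 ℕ.+ m) ≈ p₂₁ * x 2 + p₂₂ * x 1
    first-period-row₂ = sym (trans (first-period 3)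
      (solve 2 (λ z y → (:- (:- con (+ 0))) :* z :+ (:- (:- con (+ 1))) :* y := y) refl
             (x (2 ℕ.+ m)) (x (1 ℕ.+ m))))

    -- x_{m+1}, x_{m+2}, … obey the linear recurrence with the shifted coefficients, which are d again
    second-period-row₂ : p₂₁ * x (2 ℕ.+ m) + p₂₂ * x (1 ℕ.+ m) ≈ x (suc (m ℕ.+ m))
    second-period-row₂ = begin
      p₂₁ * x (2 ℕ.+ m) + p₂₂ * x (1 ℕ.+ m)
        ≈⟨ +-cong (*-congʳ (altSum-cong true m 3 shifted)) (*-congʳ (altSum-cong false m 4 shifted)) ⟩
      altSum true d′ m 3 * x (2 ℕ.+ m) + altSum false d′ m 4 * x (1 ℕ.+ m)
        ≈⟨ transferM d′ (λ i → x (suc (i ℕ.+ m))) (λ l → linear-recurrence (l ℕ.+ m)) m 3 ⟩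
      (- - 0#) * x (suc (suc m ℕ.+ m)) + (- - 1#) * x (suc (m ℕ.+ m))
        ≈⟨ solve 2 (λ z y → (:- (:- con (+ 0))) :* z :+ (:- (:- con (+ 1))) :* y := y) refl _ _ ⟩
      x (suc (m ℕ.+ m)) ∎
      where
      d′ = λ i → γ (suc (i ℕ.+ m))
      shifted : ∀ i → d i ≈ d′ i
      shifted i = sym (cSeq-periodic (suc i) (s≤s z≤n))

    -- Cayley–Hamilton for the transfer matrix, of determinant 1
    initial-relation : x 1 + x (1 ℕ.+ 2 ℕ.* m) ≈ traceM d m * x (1 ℕ.+ m)
    initial-relation = begin
      x 1 + x (1 ℕ.+ 2 ℕ.* m)
        ≈⟨ +-cong (trans (*-congʳ (detM≈1 d m)) (*-identityˡ _)) (x-cong (≡.cong suc m+m≡2m)) ⟨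
      (p₁₁ * p₂₂ - p₁₂ * p₂₁) * x 1 + x (suc (m ℕ.+ m))
        ≈⟨ +-congˡ second-period-row₂ ⟨
      (p₁₁ * p₂₂ - p₁₂ * p₂₁) * x 1 + (p₂₁ * x (2 ℕ.+ m) + p₂₂ * x (1 ℕ.+ m))
        ≈⟨ +-congˡ (+-congʳ (*-congˡ first-period-row₁)) ⟩
      (p₁₁ * p₂₂ - p₁₂ * p₂₁) * x 1 + (p₂₁ * (p₁₁ * x 2 + p₁₂ * x 1) + p₂₂ * x (1 ℕ.+ m))
        ≈⟨ solve 7 (λ a b c d x₁ x₂ y → (a :* d :- b :* c) :* x₁ :+ (c :* (a :* x₂ :+ b :* x₁) :+ d :* y)
                                       := a :* (c :* x₂ :+ d :* x₁) :+ d :* y)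
                 refl p₁₁ p₁₂ p₂₁ p₂₂ (x 1) (x 2) (x (1 ℕ.+ m)) ⟩
      p₁₁ * (p₂₁ * x 2 + p₂₂ * x 1) + p₂₂ * x (1 ℕ.+ m)
        ≈⟨ +-congʳ (*-congˡ first-period-row₂) ⟨
      p₁₁ * x (1 ℕ.+ m) + p₂₂ * x (1 ℕ.+ m)
        ≈⟨ distribʳ _ _ _ ⟨
      traceM d m * x (1 ℕ.+ m) ∎
      where
      m+m≡2m : m ℕ.+ m ≡ 2 ℕ.* m
      m+m≡2m = ≡.cong (m ℕ.+_) (≡.sym (ℕₚ.+-identityʳ m))

    somos-step : ∀ n → 1 ≤ n →
      (x n + x (n ℕ.+ 2 ℕ.* m)) * x (suc (n ℕ.+ m)) ≈ (x (suc n) + x (suc n ℕ.+ 2 ℕ.* m)) * x (n ℕ.+ m)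
    somos-step n 1≤n = begin
      (x n + x (n ℕ.+ 2 ℕ.* m)) * x (suc (n ℕ.+ m))
        ≈⟨ distribʳ _ _ _ ⟩
      x n * x (suc (n ℕ.+ m)) + x (n ℕ.+ 2 ℕ.* m) * x (suc (n ℕ.+ m))
        ≈⟨ +-cong (*-congˡ (x-cong (≡.sym (ℕₚ.+-suc n m))))
                  (trans (*-comm _ _) (*-congˡ (x-cong (n+2m≡n+m+m n m)))) ⟩
      x n * x (n ℕ.+ suc m) + x (suc (n ℕ.+ m)) * x (n ℕ.+ m ℕ.+ m)
        ≈⟨ equal-differences (somos n 1≤n) (somos (n ℕ.+ m) (ℕₚ.≤-trans 1≤n (ℕₚ.m≤m+n n m))) ⟩
      x (suc n) * x (n ℕ.+ m) + x (n ℕ.+ m) * x (n ℕ.+ m ℕ.+ suc m)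
        ≈⟨ +-congˡ (trans (*-comm _ _) (*-congʳ (x-cong (n+m+1+m≡1+n+2m n m)))) ⟩
      x (suc n) * x (n ℕ.+ m) + x (suc n ℕ.+ 2 ℕ.* m) * x (n ℕ.+ m)
        ≈⟨ distribʳ _ _ _ ⟨
      (x (suc n) + x (suc n ℕ.+ 2 ℕ.* m)) * x (n ℕ.+ m) ∎
      where
      n+2m≡n+m+m : ∀ n m → n ℕ.+ 2 ℕ.* m ≡ n ℕ.+ m ℕ.+ m
      n+2m≡n+m+m = solve-∀
      n+m+1+m≡1+n+2m : ∀ n m → n ℕ.+ m ℕ.+ suc m ≡ suc n ℕ.+ 2 ℕ.* m
      n+m+1+m≡1+n+2m = solve-∀

    linear-relation : ∀ n → 1 ≤ n → x n + x (n ℕ.+ 2 ℕ.* m) ≈ traceM d m * x (n ℕ.+ m)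
    linear-relation (suc zero) _ = initial-relation
    linear-relation (suc (suc j)) _ = *-cancelʳ-invertible (begin
      (x (2 ℕ.+ j) + x (2 ℕ.+ j ℕ.+ 2 ℕ.* m)) * x (suc j ℕ.+ m)
        ≈⟨ somos-step (suc j) (s≤s z≤n) ⟨
      (x (suc j) + x (suc j ℕ.+ 2 ℕ.* m)) * x (2 ℕ.+ j ℕ.+ m)
        ≈⟨ *-congʳ (linear-relation (suc j) (s≤s z≤n)) ⟩
      traceM d m * x (suc j ℕ.+ m) * x (2 ℕ.+ j ℕ.+ m)
        ≈⟨ xy∙z≈xz∙y _ _ _ ⟩
      traceM d m * x (2 ℕ.+ j ℕ.+ m) * x (suc j ℕ.+ m) ∎) (x-inv (suc j ℕ.+ m) (s≤s z≤n))

mainTheorem14 : ∀ {c ℓ} (R : CommutativeRing c ℓ) →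
    let module Rg = CommutativeRing R in
    (N : ℕ) → 2 ≤ N → (x inv : ℕ → Rg.Carrier) →
    (∀ n → 1 ≤ n → (x n Rg.* inv n) Rg.≈ Rg.1#) →
    (∀ n → 1 ≤ n → (x n Rg.* x (n ℕ.+ N)) Rg.≈ ((x (suc n) Rg.* x (n ℕ.+ (N ∸ 1))) Rg.+ Rg.1#)) →
    ∀ n → 1 ≤ n →
    (x n Rg.+ x (n ℕ.+ 2 ℕ.* (N ∸ 1))) Rg.≈ (S₁ R (cSeq R x inv) N Rg.* x (n ℕ.+ (N ∸ 1)))
-- N ≥ 2 only rules out N = 0: for N = 1 the recurrence says x_n x_{n+1} = x_{n+1} x_n + 1,
-- so the ring is trivial.
mainTheorem14 R (suc m) _ x inv x-inv somos n 1≤n = begin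
  x n + x (n ℕ.+ 2 ℕ.* m)                   ≈⟨ linear-relation R x inv m x-inv somos n 1≤n ⟩
  traceM R (λ i → γ (suc i)) m * x (n ℕ.+ m)  ≈⟨ *-congʳ (S₁≈traceM R γ m) ⟨
  S₁ R γ (suc m) * x (n ℕ.+ m)                ∎
  where
  open CommutativeRing R
  open import Relation.Binary.Reasoning.Setoid setoid
  γ = cSeq R x inv
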